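{- For every integer $n\ge3$, if $R$ is an incompatible set of triplets over $n$ labels and $|R|>n-1$, then some proper subset of $R$ is incompatible.
   Context: A rooted phylogenetic tree is a tree with a distinguished vertex called the root, in which no non-root vertex has degree two, and whose leaves are in bijection with a label set. It is binary if the root has degree two and every other internal vertex has degree three. A triplet is a rooted binary tree with exactly three leaves; $ab|c$ denotes the triplet on $\{a,b,c\}$ in which the path between the leaves $a$ and $b$ does not contain the root. For a rooted tree $T$ and $L\subseteq\mathcal{L}(T)$, the restriction $T|L$ is obtained from the minimal subtree $T'$ of $T$ connecting the leaves labeled by $L$ by taking as root the vertex of $T'$ closest to the root of $T$ and suppressing every non-root degree-two vertex. A rooted tree $T$ displays a rooted tree $T'$ if $T'$ can be obtained from $T|\mathcal{L}(T')$ by contracting edges. A set of rooted trees is compatible if some rooted phylogenetic tree displays all of them, and incompatible otherwise. "Over $n$ labels" means the union of the label sets of the triplets in $R$ has exactly $n$ elements. -}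

module Defs where

open import Data.Nat using (ℕ; _≤_; _<_; _∸_)
open import Data.Nat.Properties using (_≟_)
open import Data.List using (List; []; _∷_; _++_; length; concatMap)
open import Data.List.Relation.Unary.All using (All)
open import Data.List.Relation.Unary.Unique.Propositional using (Unique)
open import Data.List.Relation.Binary.Permutation.Propositional using (_↭_)
open import Data.List.Relation.Binary.Sublist.Propositional using (_⊆_)
open import Data.List.Membership.Propositional using (_∈_)
open import Data.List.Membership.DecPropositional _≟_ using (_∈?_)
open import Data.Maybe using (Maybe; just; nothing)
open import Data.Product using (Σ; ∃; _×_; _,_)
open import Data.Sum using (_⊎_)
open import Relation.Nullary using (¬_; yes; no)
open import Relation.Binary.PropositionalEquality using (_≡_)
open import Function.Bundles using (_⇔_)

Label : Set
Label = ℕ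

-- Rooted trees with labelled leaves; an internal vertex is a node with its
-- (unordered, order is irrelevant up to _↭_) list of children.
data Tree : Set where
  leaf : Label → Tree
  node : List Tree → Tree

leaves : Tree → List Label
leavesL : List Tree → List Label
leaves (leaf a) = a ∷ []
leaves (node ts) = leavesL ts
leavesL [] = []
leavesL (t ∷ ts) = leaves t ++ leavesL ts

-- Shape condition: every internal vertex has at least two children
-- (root of degree >= 2, no non-root vertex of degree two).
data Shape : Tree → Set where
  leafS : ∀ a → Shape (leaf a)
  nodeS : ∀ {ts} → 2 ≤ length ts → All Shape ts → Shape (node ts)

IsPhylo : Tree → Set
IsPhylo T = Shape T × Unique (leaves T)

-- Restriction T|L: keep leaves in L, delete empty parts, and suppress vertices
-- left with a single child (including at the top: new root = vertex closest to root).
restrict : List Label → Tree → Maybe Tree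
restrictL : List Label → List Tree → List Tree
restrict L (leaf a) with a ∈? L
... | yes _ = just (leaf a)
... | no _ = nothing
restrict L (node ts) with restrictL L ts
... | [] = nothing
... | t ∷ [] = just t
... | t ∷ u ∷ us = just (node (t ∷ u ∷ us))
restrictL L [] = []
restrictL L (t ∷ ts) with restrict L t
... | just t' = t' ∷ restrictL L ts
... | nothing = restrictL L ts

-- S ⇝ T : T is obtained from S by contracting (internal) edges, up to isomorphism
-- (reordering children).  Splicing a child node's children into its parent
-- is contraction of the edge between them.
data _⇝_ : Tree → Tree → Set
data _⇝*_ : List Tree → List Tree → Set
data _⇝_ where
  leaf⇝ : ∀ a → leaf a ⇝ leaf a
  node⇝ : ∀ {ts us vs} → ts ⇝* us → us ↭ vs → node ts ⇝ node vs
data _⇝*_ where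
  []⇝ : [] ⇝* []
  keep : ∀ {t u ts us} → t ⇝ u → ts ⇝* us → (t ∷ ts) ⇝* (u ∷ us)
  splice : ∀ {ss us ts vs} → ss ⇝* us → ts ⇝* vs → (node ss ∷ ts) ⇝* (us ++ vs)

Displays : Tree → Tree → Set
Displays T T' = Σ Tree λ S → (restrict (leaves T') T ≡ just S) × (S ⇝ T')

record Triplet : Set where
  constructor _∣_∣_⟨_,_,_⟩
  field
    a b c : Label
    a≢b : ¬ a ≡ b
    a≢c : ¬ a ≡ c
    b≢c : ¬ b ≡ c

tripletTree : Triplet → Tree
tripletTree t = node (node (leaf a ∷ leaf b ∷ []) ∷ leaf c ∷ [])
  where open Triplet t

SameTriplet : Triplet → Triplet → Set
SameTriplet t u = (Triplet.c t ≡ Triplet.c u) ×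
  ((Triplet.a t ≡ Triplet.a u × Triplet.b t ≡ Triplet.b u) ⊎
   (Triplet.a t ≡ Triplet.b u × Triplet.b t ≡ Triplet.a u))

data TripletSet : List Triplet → Set where
  []ₛ : TripletSet []
  _∷ₛ_ : ∀ {t R} → All (λ u → ¬ SameTriplet t u) R → TripletSet R → TripletSet (t ∷ R)

Compatible : List Triplet → Set
Compatible R = Σ Tree λ T → IsPhylo T × All (λ t → Displays T (tripletTree t)) R

Incompatible : List Triplet → Set
Incompatible R = ¬ Compatible R

tripletLabels : List Triplet → List Label
tripletLabels = concatMap (λ t → Triplet.a t ∷ Triplet.b t ∷ Triplet.c t ∷ [])

OverLabels : List Triplet → ℕ → Set
OverLabels R n = Σ (List Label) λ L →
  Unique L × (∀ x → (x ∈ L) ⇔ (x ∈ tripletLabels R)) × length L ≡ n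

-- Aho's algorithm. From a label r, grow the connected component of r in the
-- graph having an edge ab for every triplet ab|c of R whose labels are all
-- present, and record one such triplet for each label added. If the component
-- misses a label, the labels split into the component and the rest, no
-- triplet separates its a and b across the split, and binary trees built
-- recursively on the two parts, joined under a new root, display R. If the
-- component contains all n labels, the at most n − 1 recorded triplets are
-- already incompatible: in a tree displaying them, every recorded ab|c puts a
-- and b below the same child of the root, so the child containing r contains
-- all labels of the component and displays the recorded triplets by itself;
-- descending, we would reach a leaf displaying a triplet.
module Submission where

open import Defs
open import Data.Nat using (ℕ; zero; suc; _≤_; _<_; _∸_; z≤n; s≤s; s≤s⁻¹)
open import Data.Nat.Properties
  using (_≟_; ≤-refl; ≤-reflexive; ≤-trans; ≤-<-trans; n≤1+n;
         suc[m]≤n⇒m≤pred[n]; pred[m∸n]≡m∸[1+n])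
open import Data.List using (List; []; _∷_; _++_; length; fromMaybe)
open import Data.List.Properties using (++-identityʳ; length-++-≤ˡ; length-++-≤ʳ; length-++-sucʳ)
open import Data.List.Relation.Unary.All as All using (All; []; _∷_; all?)
open import Data.List.Relation.Unary.All.Properties using (++⁻ˡ)
open import Data.List.Relation.Unary.Any as Any using (Any; here; there; _─_; any?)
open import Data.List.Relation.Unary.Any.Properties using () renaming (++⁻ to Any-++⁻)
open import Data.List.Relation.Unary.Unique.Propositional using (Unique; []; _∷_)
import Data.List.Relation.Unary.Unique.Propositional.Properties as Unique
open import Data.List.Relation.Binary.Disjoint.Propositional using (Disjoint)
import Data.List.Relation.Binary.Disjoint.Propositional.Properties as Disjoint
open import Data.List.Relation.Binary.Permutation.Propositional
  using (_↭_; ↭-refl; ↭-sym; ↭-trans; prep; swap; ↭⇒↭ₛ)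
open import Data.List.Relation.Binary.Permutation.Propositional.Properties
  using (∈-resp-↭; Any-resp-↭; ↭-length; shift; ++⁺ˡ)
import Data.List.Relation.Binary.Permutation.Setoid.Properties as PermutationSetoid
open import Data.List.Relation.Binary.Sublist.Propositional using (_⊆_; []; _∷_; _∷ʳ_; minimum)
open import Data.List.Membership.Propositional using (_∈_; _∉_; find; lose)
open import Data.List.Membership.Propositional.Properties using (∈-++⁺ˡ; ∈-++⁺ʳ; ∈-++⁻; ∈-concatMap⁺)
open import Data.List.Membership.DecPropositional _≟_ using (_∈?_)
open import Data.Maybe using (Maybe; just; nothing)
open import Data.Product using (Σ; ∃; _×_; _,_; proj₁; proj₂; map₁)
open import Data.Sum using (_⊎_; inj₁; inj₂)
import Data.Sum as Sum
import Data.Product as Product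
open import Data.Empty using (⊥-elim)
open import Function using (_∘_; id; const)
open import Function.Bundles using (_⇔_; mk⇔; Equivalence)
open import Relation.Nullary using (¬_; Dec; yes; no; contradiction; contraposition)
open import Relation.Nullary.Decidable using (_×-dec_; _⊎-dec_)
open import Relation.Binary.PropositionalEquality
  using (_≡_; refl; sym; trans; cong; cong₂; subst; setoid; module ≡-Reasoning)

open ≡-Reasoning

Unique-++⁻ : ∀ {A : Set} (xs : List A) {ys} → Unique (xs ++ ys) →
  Unique xs × Unique ys × Disjoint xs ys
Unique-++⁻ [] u = [] , u , λ { (() , _) }
Unique-++⁻ (x ∷ xs) (x∉ ∷ u) =
  let uxs , uys , xs#ys = Unique-++⁻ xs u in
  ++⁻ˡ xs x∉ ∷ uxs , uys , λ
    { (here refl , x∈ys) → All.lookup x∉ (∈-++⁺ʳ xs x∈ys) refl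
    ; (there y∈xs , y∈ys) → xs#ys (y∈xs , y∈ys) }

Unique-resp-↭ : ∀ {A : Set} {xs ys : List A} → xs ↭ ys → Unique xs → Unique ys
Unique-resp-↭ {A} p = PermutationSetoid.Unique-resp-↭ (setoid A) (↭⇒↭ₛ p)

↭-─ : ∀ {A : Set} {x : A} {xs} (x∈xs : x ∈ xs) → xs ↭ x ∷ (xs ─ x∈xs)
↭-─ (here refl) = ↭-refl
↭-─ (there x∈xs) = ↭-trans (prep _ (↭-─ x∈xs)) (swap _ _ ↭-refl)

⊆-insert : ∀ {A : Set} {x : A} {ys xs} → ys ⊆ xs → x ∈ xs →
  ∃ λ zs → zs ⊆ xs × x ∈ zs × (∀ {y} → y ∈ ys → y ∈ zs) × length zs ≤ suc (length ys)
⊆-insert [] ()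
⊆-insert (y ∷ʳ τ) (here refl) = _ , refl ∷ τ , here refl , there , ≤-refl
⊆-insert (y ∷ʳ τ) (there x∈xs) =
  let zs , σ , x∈zs , ys⊆zs , len = ⊆-insert τ x∈xs in
  zs , y ∷ʳ σ , x∈zs , ys⊆zs , len
⊆-insert (refl ∷ τ) (here refl) = _ , refl ∷ τ , here refl , id , n≤1+n _
⊆-insert (refl ∷ τ) (there x∈xs) =
  let zs , σ , x∈zs , ys⊆zs , len = ⊆-insert τ x∈xs in
  _ , refl ∷ σ , there x∈zs , (λ { (here refl) → here refl ; (there y∈ys) → there (ys⊆zs y∈ys) }) , s≤s len

covering-sublist : ∀ {A : Set} {xs E : List A} → All (_∈ xs) E →
  ∃ λ ys → ys ⊆ xs × length ys ≤ length E × All (_∈ ys) E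
covering-sublist [] = [] , minimum _ , z≤n , []
covering-sublist (e∈xs ∷ E⊆xs) =
  let ys , τ , len , E⊆ys = covering-sublist E⊆xs
      zs , σ , e∈zs , ys⊆zs , len′ = ⊆-insert τ e∈xs
  in zs , σ , ≤-trans len′ (s≤s len) , e∈zs ∷ All.map ys⊆zs E⊆ys

-- Restriction and contraction

collapse : List Tree → Maybe Tree
collapse [] = nothing
collapse (t ∷ []) = just t
collapse ts@(_ ∷ _ ∷ _) = just (node ts)

restrict-node : ∀ X ts → restrict X (node ts) ≡ collapse (restrictL X ts)
restrict-node X ts with restrictL X ts
... | [] = refl
... | _ ∷ [] = refl
... | _ ∷ _ ∷ _ = refl

restrictL-∷ : ∀ X t ts → restrictL X (t ∷ ts) ≡ fromMaybe (restrict X t) ++ restrictL X ts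
restrictL-∷ X t ts with restrict X t
... | just _ = refl
... | nothing = refl

collapse-fromMaybe : ∀ m → collapse (fromMaybe m ++ []) ≡ m
collapse-fromMaybe (just t) = refl
collapse-fromMaybe nothing = refl

restrict-disjoint : ∀ X t → Disjoint (leaves t) X → restrict X t ≡ nothing
restrictL-disjoint : ∀ X ts → Disjoint (leavesL ts) X → restrictL X ts ≡ []
restrict-disjoint X (leaf a) a#X with a ∈? X
... | yes a∈X = ⊥-elim (a#X (here refl , a∈X))
... | no _ = refl
restrict-disjoint X (node ts) ts#X =
  trans (restrict-node X ts) (cong collapse (restrictL-disjoint X ts ts#X))
restrictL-disjoint X [] _ = refl
restrictL-disjoint X (t ∷ ts) tts#X rewrite restrictL-∷ X t ts
  | restrict-disjoint X t (tts#X ∘ map₁ ∈-++⁺ˡ) = restrictL-disjoint X ts (tts#X ∘ map₁ (∈-++⁺ʳ (leaves t)))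

restrict-node-head : ∀ X t ts → Disjoint (leavesL ts) X → restrict X (node (t ∷ ts)) ≡ restrict X t
restrict-node-head X t ts ts#X = begin
  restrict X (node (t ∷ ts))                            ≡⟨ restrict-node X (t ∷ ts) ⟩
  collapse (restrictL X (t ∷ ts))                       ≡⟨ cong collapse (restrictL-∷ X t ts) ⟩
  collapse (fromMaybe (restrict X t) ++ restrictL X ts) ≡⟨ cong (λ us → collapse (fromMaybe (restrict X t) ++ us))
                                                               (restrictL-disjoint X ts ts#X) ⟩
  collapse (fromMaybe (restrict X t) ++ [])             ≡⟨ collapse-fromMaybe (restrict X t) ⟩
  restrict X t                                          ∎

restrict-node-tail : ∀ X t ts → Disjoint (leaves t) X → restrict X (node (t ∷ ts)) ≡ restrict X (node ts)
restrict-node-tail X t ts t#X = begin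
  restrict X (node (t ∷ ts))                            ≡⟨ restrict-node X (t ∷ ts) ⟩
  collapse (restrictL X (t ∷ ts))                       ≡⟨ cong collapse (restrictL-∷ X t ts) ⟩
  collapse (fromMaybe (restrict X t) ++ restrictL X ts) ≡⟨ cong (λ m → collapse (fromMaybe m ++ restrictL X ts))
                                                               (restrict-disjoint X t t#X) ⟩
  collapse (restrictL X ts)                             ≡⟨ sym (restrict-node X ts) ⟩
  restrict X (node ts)                                  ∎

∈-leavesL⁻ : ∀ ts {x} → x ∈ leavesL ts → Any (λ t → x ∈ leaves t) ts
∈-leavesL⁻ (t ∷ ts) x∈ with ∈-++⁻ (leaves t) x∈
... | inj₁ x∈t = here x∈t
... | inj₂ x∈ts = there (∈-leavesL⁻ ts x∈ts)

∈-leavesL⁺ : ∀ ts {x} → Any (λ t → x ∈ leaves t) ts → x ∈ leavesL ts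
∈-leavesL⁺ (t ∷ ts) (here x∈t) = ∈-++⁺ˡ x∈t
∈-leavesL⁺ (t ∷ ts) (there x∈ts) = ∈-++⁺ʳ (leaves t) (∈-leavesL⁺ ts x∈ts)

leaves-collapse : ∀ ts {s x} → collapse ts ≡ just s → x ∈ leaves s → x ∈ leavesL ts
leaves-collapse (t ∷ []) refl x∈s = ∈-++⁺ˡ x∈s
leaves-collapse (t ∷ u ∷ us) refl x∈s = x∈s

leaves-restrict : ∀ X t {s x} → restrict X t ≡ just s → x ∈ leaves s → x ∈ leaves t
leaves-restrictL : ∀ X ts {x} → x ∈ leavesL (restrictL X ts) → x ∈ leavesL ts
leaves-restrict X (leaf a) eq x∈s with a ∈? X
leaves-restrict X (leaf a) refl x∈s | yes _ = x∈s
leaves-restrict X (node ts) eq x∈s =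
  leaves-restrictL X ts (leaves-collapse (restrictL X ts) (trans (sym (restrict-node X ts)) eq) x∈s)
leaves-restrictL X [] x∈ = x∈
leaves-restrictL X (t ∷ ts) x∈ with restrict X t in eq
... | nothing = ∈-++⁺ʳ (leaves t) (leaves-restrictL X ts x∈)
... | just s with ∈-++⁻ (leaves s) x∈
...   | inj₁ x∈s = ∈-++⁺ˡ (leaves-restrict X t eq x∈s)
...   | inj₂ x∈ts = ∈-++⁺ʳ (leaves t) (leaves-restrictL X ts x∈ts)

SameChild : List Tree → Label → Label → Set
SameChild ts a b = Any (λ t → a ∈ leaves t × b ∈ leaves t) ts

sameChild-restrictL : ∀ X ts {a b} → SameChild (restrictL X ts) a b → SameChild ts a b
sameChild-restrictL X [] ()
sameChild-restrictL X (t ∷ ts) p with restrict X t in eq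
sameChild-restrictL X (t ∷ ts) (here (a∈ , b∈)) | just s =
  here (leaves-restrict X t eq a∈ , leaves-restrict X t eq b∈)
sameChild-restrictL X (t ∷ ts) (there p) | just s = there (sameChild-restrictL X ts p)
sameChild-restrictL X (t ∷ ts) p | nothing = there (sameChild-restrictL X ts p)

⇝-refl : ∀ t → t ⇝ t
⇝*-refl : ∀ ts → ts ⇝* ts
⇝-refl (leaf a) = leaf⇝ a
⇝-refl (node ts) = node⇝ (⇝*-refl ts) ↭-refl
⇝*-refl [] = []⇝
⇝*-refl (t ∷ ts) = keep (⇝-refl t) (⇝*-refl ts)

leaves-⇝ : ∀ {S T x} → S ⇝ T → x ∈ leaves T → x ∈ leaves S
leaves-⇝* : ∀ {ts us x} → ts ⇝* us → x ∈ leavesL us → x ∈ leavesL ts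
leaves-⇝ (leaf⇝ a) x∈ = x∈
leaves-⇝ (node⇝ {us = us} {vs} ts⇝us π) x∈ =
  leaves-⇝* ts⇝us (∈-leavesL⁺ us (Any-resp-↭ (↭-sym π) (∈-leavesL⁻ vs x∈)))
leaves-⇝* []⇝ x∈ = x∈
leaves-⇝* (keep {t} {u} t⇝u ts⇝us) x∈ with ∈-++⁻ (leaves u) x∈
... | inj₁ x∈u = ∈-++⁺ˡ (leaves-⇝ t⇝u x∈u)
... | inj₂ x∈us = ∈-++⁺ʳ (leaves t) (leaves-⇝* ts⇝us x∈us)
leaves-⇝* (splice {ss} {us} {ts} {vs} ss⇝us ts⇝vs) x∈ with Any-++⁻ us (∈-leavesL⁻ (us ++ vs) x∈)
... | inj₁ x∈us = ∈-++⁺ˡ (leaves-⇝* ss⇝us (∈-leavesL⁺ us x∈us))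
... | inj₂ x∈vs = ∈-++⁺ʳ (leavesL ss) (leaves-⇝* ts⇝vs (∈-leavesL⁺ vs x∈vs))

sameChild-⇝* : ∀ {ts us a b} → ts ⇝* us → SameChild us a b → SameChild ts a b
sameChild-⇝* []⇝ ()
sameChild-⇝* (keep t⇝u _) (here (a∈ , b∈)) = here (leaves-⇝ t⇝u a∈ , leaves-⇝ t⇝u b∈)
sameChild-⇝* (keep _ ts⇝us) (there p) = there (sameChild-⇝* ts⇝us p)
sameChild-⇝* (splice {ss} {us} ss⇝us ts⇝vs) p with Any-++⁻ us p
... | inj₁ p′ = let q = sameChild-⇝* ss⇝us p′ in
  here (∈-leavesL⁺ ss (Any.map proj₁ q) , ∈-leavesL⁺ ss (Any.map proj₂ q))
... | inj₂ p′ = there (sameChild-⇝* ts⇝vs p′)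

labels : Triplet → List Label
labels e = leaves (tripletTree e)

Within : List Label → Triplet → Set
Within L e = All (_∈ L) (labels e)

displays-≡ : ∀ T U {T′} → restrict (leaves T′) T ≡ restrict (leaves T′) U → Displays T T′ → Displays U T′
displays-≡ _ _ eq (s , eqs , s⇝T′) = s , trans (sym eq) eqs , s⇝T′

leaf-¬displays : ∀ x e → ¬ Displays (leaf x) (tripletTree e)
leaf-¬displays x e (s , eq , s⇝e) with x ∈? labels e
leaf-¬displays x e (s , refl , ()) | yes _
leaf-¬displays x e (s , () , _) | no _

collapse-sameChild : ∀ ts {s} e → collapse ts ≡ just s → s ⇝ tripletTree e →
  SameChild ts (Triplet.a e) (Triplet.b e)
collapse-sameChild (t ∷ []) e refl t⇝e = here (leaves-⇝ t⇝e (here refl) , leaves-⇝ t⇝e (there (here refl)))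
collapse-sameChild (t ∷ u ∷ us) e refl (node⇝ ts⇝ π) =
  sameChild-⇝* ts⇝ (Any-resp-↭ (↭-sym π) (here (here refl , there (here refl))))

displays-node⇒sameChild : ∀ ts e → Displays (node ts) (tripletTree e) → SameChild ts (Triplet.a e) (Triplet.b e)
displays-node⇒sameChild ts e (s , eq , s⇝e) =
  sameChild-restrictL (labels e) ts (collapse-sameChild _ e (trans (sym (restrict-node (labels e) ts)) eq) s⇝e)

sameChild-head⇔ : ∀ t ts {a b} → Disjoint (leaves t) (leavesL ts) → SameChild (t ∷ ts) a b →
  a ∈ leaves t ⇔ b ∈ leaves t
sameChild-head⇔ t ts _ (here (a∈t , b∈t)) = mk⇔ (const b∈t) (const a∈t)
sameChild-head⇔ t ts t#ts (there p) =
  mk⇔ (λ a∈t → ⊥-elim (t#ts (a∈t , ∈-leavesL⁺ ts (Any.map proj₁ p))))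
      (λ b∈t → ⊥-elim (t#ts (b∈t , ∈-leavesL⁺ ts (Any.map proj₂ p))))

-- Connected sets of triplets

Links : List Label → Label → Triplet → Set
Links S x e = (Triplet.a e ∈ S × Triplet.b e ≡ x) ⊎ (Triplet.b e ∈ S × Triplet.a e ≡ x)

-- The triplets of E, read as edges ab, form a spanning tree of S.
data Connected (r : Label) : List Label → List Triplet → Set where
  start : Connected r (r ∷ []) []
  extend : ∀ {S E x} e → Connected r S E → Links S x e → Connected r (x ∷ S) (e ∷ E)

connected-length : ∀ {r S E} → Connected r S E → length S ≡ suc (length E)
connected-length start = refl
connected-length (extend _ conn _) = cong suc (connected-length conn)

connected-edge : ∀ {r S E} → Connected r S E → 2 ≤ length S → ∃ (_∈ E)
connected-edge start (s≤s ())
connected-edge (extend e _ _) _ = e , here refl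

connected-closed : ∀ {r S E} (P : Label → Set) → Connected r S E → P r →
  (∀ {e} → e ∈ E → P (Triplet.a e) ⇔ P (Triplet.b e)) → All P S
connected-closed P start Pr _ = Pr ∷ []
connected-closed P (extend e conn links) Pr closed = P-new links ∷ PS
  where
  PS = connected-closed P conn Pr (closed ∘ there)
  P-new : ∀ {x} → Links _ x e → P x
  P-new (inj₁ (a∈S , refl)) = Equivalence.to (closed (here refl)) (All.lookup PS a∈S)
  P-new (inj₂ (b∈S , refl)) = Equivalence.from (closed (here refl)) (All.lookup PS b∈S)

DisplaysAll : Tree → List Triplet → Set
DisplaysAll T E = All (λ e → Displays T (tripletTree e)) E

module _ {r S E} (conn : Connected r S E) {e₀} (e₀∈E : e₀ ∈ E) (E-within : All (Within S) E) where

  private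
    head⇔ : ∀ t ts → Disjoint (leaves t) (leavesL ts) → DisplaysAll (node (t ∷ ts)) E →
      ∀ {e} → e ∈ E → Triplet.a e ∈ leaves t ⇔ Triplet.b e ∈ leaves t
    head⇔ t ts t#ts ds {e} e∈E =
      sameChild-head⇔ t ts t#ts (displays-node⇒sameChild (t ∷ ts) e (All.lookup ds e∈E))

  connected-¬displays : ∀ T → Unique (leaves T) → ¬ DisplaysAll T E
  connected-¬displaysL : ∀ ts → Unique (leavesL ts) → ¬ DisplaysAll (node ts) E
  connected-¬displays (leaf x) _ ds = leaf-¬displays x e₀ (All.lookup ds e₀∈E)
  connected-¬displays (node ts) u ds = connected-¬displaysL ts u ds
  connected-¬displaysL [] _ ds with All.lookup ds e₀∈E
  ... | _ , () , _
  connected-¬displaysL (t ∷ ts) u ds with Unique-++⁻ (leaves t) u | r ∈? leaves t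
  ... | uₜ , _ , t#ts | yes r∈t =
    connected-¬displays t uₜ (All.tabulate λ {e} e∈E →
      displays-≡ (node (t ∷ ts)) t (restrict-node-head (labels e) t ts (ts#e e∈E)) (All.lookup ds e∈E))
    where
    S⊆t : All (_∈ leaves t) S
    S⊆t = connected-closed (_∈ leaves t) conn r∈t (head⇔ t ts t#ts ds)
    ts#e : ∀ {e} → e ∈ E → Disjoint (leavesL ts) (labels e)
    ts#e e∈E (x∈ts , x∈e) = t#ts (All.lookup S⊆t (All.lookup (All.lookup E-within e∈E) x∈e) , x∈ts)
  ... | _ , uₜₛ , t#ts | no r∉t =
    connected-¬displaysL ts uₜₛ (All.tabulate λ {e} e∈E →
      displays-≡ (node (t ∷ ts)) (node ts) (restrict-node-tail (labels e) t ts (t#e e∈E)) (All.lookup ds e∈E))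
    where
    S#t : All (_∉ leaves t) S
    S#t = connected-closed (_∉ leaves t) conn r∉t λ e∈E →
      let a⇔b = head⇔ t ts t#ts ds e∈E in
      mk⇔ (contraposition (Equivalence.from a⇔b)) (contraposition (Equivalence.to a⇔b))
    t#e : ∀ {e} → e ∈ E → Disjoint (leaves t) (labels e)
    t#e e∈E (x∈t , x∈e) = All.lookup S#t (All.lookup (All.lookup E-within e∈E) x∈e) x∈t

data BinTree : Set where
  tip : Label → BinTree
  bin : BinTree → BinTree → BinTree

⌊_⌋ : BinTree → Tree
⌊ tip a ⌋ = leaf a
⌊ bin l r ⌋ = node (⌊ l ⌋ ∷ ⌊ r ⌋ ∷ [])

leavesᵇ : BinTree → List Label
leavesᵇ (tip a) = a ∷ []
leavesᵇ (bin l r) = leavesᵇ l ++ leavesᵇ r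

leaves-⌊⌋ : ∀ B → leaves ⌊ B ⌋ ≡ leavesᵇ B
leaves-⌊⌋ (tip a) = refl
leaves-⌊⌋ (bin l r) = begin
  leaves ⌊ l ⌋ ++ leaves ⌊ r ⌋ ++ [] ≡⟨ cong (leaves ⌊ l ⌋ ++_) (++-identityʳ (leaves ⌊ r ⌋)) ⟩
  leaves ⌊ l ⌋ ++ leaves ⌊ r ⌋       ≡⟨ cong₂ _++_ (leaves-⌊⌋ l) (leaves-⌊⌋ r) ⟩
  leavesᵇ l ++ leavesᵇ r             ∎

shape-⌊⌋ : ∀ B → Shape ⌊ B ⌋
shape-⌊⌋ (tip a) = leafS a
shape-⌊⌋ (bin l r) = nodeS (s≤s (s≤s z≤n)) (shape-⌊⌋ l ∷ shape-⌊⌋ r ∷ [])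

cherry : Label → Label → Tree
cherry a b = node (leaf a ∷ leaf b ∷ [])

restrict-binˡ : ∀ X l r → Disjoint (leavesᵇ r) X → restrict X ⌊ bin l r ⌋ ≡ restrict X ⌊ l ⌋
restrict-binˡ X l r r#X = restrict-node-head X ⌊ l ⌋ (⌊ r ⌋ ∷ [])
  (subst (λ ys → Disjoint ys X) (sym (trans (++-identityʳ _) (leaves-⌊⌋ r))) r#X)

restrict-binʳ : ∀ X l r → Disjoint (leavesᵇ l) X → restrict X ⌊ bin l r ⌋ ≡ restrict X ⌊ r ⌋
restrict-binʳ X l r l#X = trans
  (restrict-node-tail X ⌊ l ⌋ (⌊ r ⌋ ∷ []) (subst (λ ys → Disjoint ys X) (sym (leaves-⌊⌋ l)) l#X))
  (restrict-node-head X ⌊ r ⌋ [] λ { (() , _) })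

restrict-bin : ∀ X l r {s t} → restrict X ⌊ l ⌋ ≡ just s → restrict X ⌊ r ⌋ ≡ just t →
  restrict X ⌊ bin l r ⌋ ≡ just (node (s ∷ t ∷ []))
restrict-bin X l r eqˡ eqʳ rewrite restrict-node X (⌊ l ⌋ ∷ ⌊ r ⌋ ∷ [])
  | restrictL-∷ X ⌊ l ⌋ (⌊ r ⌋ ∷ []) | restrictL-∷ X ⌊ r ⌋ [] | eqˡ | eqʳ = refl

no-labels-beside : ∀ {l r X Y : List Label} → Disjoint l r → All (_∈ l) Y →
  (∀ {x} → x ∈ r → x ∈ X → x ∈ Y) → Disjoint r X
no-labels-beside l#r Y⊆l only (x∈r , x∈X) = l#r (All.lookup Y⊆l (only x∈r x∈X) , x∈r)

restrict-single : ∀ X B {a} → Unique (leavesᵇ B) → a ∈ leavesᵇ B → a ∈ X →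
  (∀ {x} → x ∈ leavesᵇ B → x ∈ X → x ∈ a ∷ []) → restrict X ⌊ B ⌋ ≡ just (leaf a)
restrict-single X (tip y) _ (here refl) a∈X _ with y ∈? X
... | yes _ = refl
... | no a∉X = contradiction a∈X a∉X
restrict-single X (bin l r) u a∈B a∈X only with Unique-++⁻ (leavesᵇ l) u | ∈-++⁻ (leavesᵇ l) a∈B
... | uˡ , uʳ , l#r | inj₁ a∈l = trans
  (restrict-binˡ X l r (no-labels-beside l#r (a∈l ∷ []) (only ∘ ∈-++⁺ʳ _)))
  (restrict-single X l uˡ a∈l a∈X (only ∘ ∈-++⁺ˡ))
... | uˡ , uʳ , l#r | inj₂ a∈r = trans
  (restrict-binʳ X l r (no-labels-beside (Disjoint.sym l#r) (a∈r ∷ []) (only ∘ ∈-++⁺ˡ)))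
  (restrict-single X r uʳ a∈r a∈X (only ∘ ∈-++⁺ʳ _))

∈-++-sideˡ : ∀ {l r : List Label} Y {Z x} → Disjoint l r → x ∈ l → All (_∈ r) Z → x ∈ Y ++ Z → x ∈ Y
∈-++-sideˡ Y l#r x∈l Z⊆r x∈YZ with ∈-++⁻ Y x∈YZ
... | inj₁ x∈Y = x∈Y
... | inj₂ x∈Z = ⊥-elim (l#r (x∈l , All.lookup Z⊆r x∈Z))

∈-++-sideʳ : ∀ {l r Y Z : List Label} {x} → Disjoint l r → x ∈ r → All (_∈ l) Y → x ∈ Y ++ Z → x ∈ Z
∈-++-sideʳ {Y = Y} l#r x∈r Y⊆l x∈YZ with ∈-++⁻ Y x∈YZ
... | inj₁ x∈Y = ⊥-elim (l#r (All.lookup Y⊆l x∈Y , x∈r))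
... | inj₂ x∈Z = x∈Z

restrict-pair : ∀ X B {a b} → ¬ a ≡ b → Unique (leavesᵇ B) → a ∈ leavesᵇ B → b ∈ leavesᵇ B → a ∈ X → b ∈ X →
  (∀ {x} → x ∈ leavesᵇ B → x ∈ X → x ∈ a ∷ b ∷ []) → ∃ λ s → restrict X ⌊ B ⌋ ≡ just s × s ⇝ cherry a b
restrict-pair X (tip y) a≢b _ (here refl) (here refl) _ _ _ = contradiction refl a≢b
restrict-pair X (bin l r) {a} {b} a≢b u a∈B b∈B a∈X b∈X only
  with Unique-++⁻ (leavesᵇ l) u | ∈-++⁻ (leavesᵇ l) a∈B | ∈-++⁻ (leavesᵇ l) b∈B
... | uˡ , _ , l#r | inj₁ a∈l | inj₁ b∈l =
  let s , eq , s⇝ = restrict-pair X l a≢b uˡ a∈l b∈l a∈X b∈X (only ∘ ∈-++⁺ˡ) in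
  s , trans (restrict-binˡ X l r (no-labels-beside l#r (a∈l ∷ b∈l ∷ []) (only ∘ ∈-++⁺ʳ _))) eq , s⇝
... | _ , uʳ , l#r | inj₂ a∈r | inj₂ b∈r =
  let s , eq , s⇝ = restrict-pair X r a≢b uʳ a∈r b∈r a∈X b∈X (only ∘ ∈-++⁺ʳ _) in
  s , trans (restrict-binʳ X l r (no-labels-beside (Disjoint.sym l#r) (a∈r ∷ b∈r ∷ []) (only ∘ ∈-++⁺ˡ))) eq , s⇝
... | uˡ , uʳ , l#r | inj₁ a∈l | inj₂ b∈r =
  cherry a b ,
  restrict-bin X l r
    (restrict-single X l uˡ a∈l a∈X λ x∈l → ∈-++-sideˡ (a ∷ []) l#r x∈l (b∈r ∷ []) ∘ only (∈-++⁺ˡ x∈l))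
    (restrict-single X r uʳ b∈r b∈X λ x∈r → ∈-++-sideʳ l#r x∈r (a∈l ∷ []) ∘ only (∈-++⁺ʳ _ x∈r)) ,
  ⇝-refl (cherry a b)
... | uˡ , uʳ , l#r | inj₂ a∈r | inj₁ b∈l =
  cherry b a ,
  restrict-bin X l r
    (restrict-single X l uˡ b∈l b∈X λ x∈l → ∈-++-sideʳ (Disjoint.sym l#r) x∈l (a∈r ∷ []) ∘ only (∈-++⁺ˡ x∈l))
    (restrict-single X r uʳ a∈r a∈X λ x∈r → ∈-++-sideˡ (a ∷ []) (Disjoint.sym l#r) x∈r (b∈l ∷ []) ∘ only (∈-++⁺ʳ _ x∈r)) ,
  node⇝ (⇝*-refl _) (swap _ _ ↭-refl)

Splits : List Label → List Label → Triplet → Set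
Splits S T e = (Triplet.a e ∈ S × Triplet.b e ∈ T) ⊎ (Triplet.b e ∈ S × Triplet.a e ∈ T)

module _ (B₁ B₂ : BinTree) (e : Triplet) where
  open Triplet e

  displays-bin : Unique (leavesᵇ (bin B₁ B₂)) →
    All (λ x → x ∈ leavesᵇ B₁ ⊎ x ∈ leavesᵇ B₂) (labels e) →
    ¬ Splits (leavesᵇ B₁) (leavesᵇ B₂) e →
    (Within (leavesᵇ B₁) e → Displays ⌊ B₁ ⌋ (tripletTree e)) →
    (Within (leavesᵇ B₂) e → Displays ⌊ B₂ ⌋ (tripletTree e)) →
    Displays ⌊ bin B₁ B₂ ⌋ (tripletTree e)
  displays-bin u (side-a ∷ side-b ∷ side-c ∷ []) ¬splits D₁ D₂
    with Unique-++⁻ (leavesᵇ B₁) u | side-a | side-b | side-c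
  ... | _ | inj₁ a₁ | inj₂ b₂ | _ = ⊥-elim (¬splits (inj₁ (a₁ , b₂)))
  ... | _ | inj₂ a₂ | inj₁ b₁ | _ = ⊥-elim (¬splits (inj₂ (b₁ , a₂)))
  ... | _ , _ , B₁#B₂ | inj₁ a₁ | inj₁ b₁ | inj₁ c₁ =
    displays-≡ ⌊ B₁ ⌋ ⌊ bin B₁ B₂ ⌋ (sym (restrict-binˡ (labels e) B₁ B₂ (no-labels-beside B₁#B₂ (a₁ ∷ b₁ ∷ c₁ ∷ []) (λ _ → id))))
      (D₁ (a₁ ∷ b₁ ∷ c₁ ∷ []))
  ... | _ , _ , B₁#B₂ | inj₂ a₂ | inj₂ b₂ | inj₂ c₂ =
    displays-≡ ⌊ B₂ ⌋ ⌊ bin B₁ B₂ ⌋ (sym (restrict-binʳ (labels e) B₁ B₂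
      (no-labels-beside (Disjoint.sym B₁#B₂) (a₂ ∷ b₂ ∷ c₂ ∷ []) (λ _ → id))))
      (D₂ (a₂ ∷ b₂ ∷ c₂ ∷ []))
  ... | u₁ , u₂ , B₁#B₂ | inj₁ a₁ | inj₁ b₁ | inj₂ c₂ =
    let s , eq , s⇝ = restrict-pair (labels e) B₁ a≢b u₁ a₁ b₁ (here refl) (there (here refl))
                        λ x∈₁ → ∈-++-sideˡ (a ∷ b ∷ []) B₁#B₂ x∈₁ (c₂ ∷ [])
    in _ , restrict-bin (labels e) B₁ B₂ eq
             (restrict-single (labels e) B₂ u₂ c₂ (there (there (here refl)))
               λ x∈₂ → ∈-++-sideʳ B₁#B₂ x∈₂ (a₁ ∷ b₁ ∷ [])) ,
         node⇝ (keep s⇝ (keep (leaf⇝ c) []⇝)) ↭-refl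
  ... | u₁ , u₂ , B₁#B₂ | inj₂ a₂ | inj₂ b₂ | inj₁ c₁ =
    let s , eq , s⇝ = restrict-pair (labels e) B₂ a≢b u₂ a₂ b₂ (here refl) (there (here refl))
                        λ x∈₂ → ∈-++-sideˡ (a ∷ b ∷ []) (Disjoint.sym B₁#B₂) x∈₂ (c₁ ∷ [])
    in _ , restrict-bin (labels e) B₁ B₂
             (restrict-single (labels e) B₁ u₁ c₁ (there (there (here refl)))
               λ x∈₁ → ∈-++-sideʳ (Disjoint.sym B₁#B₂) x∈₁ (a₂ ∷ b₂ ∷ []))
             eq ,
         node⇝ (keep (leaf⇝ c) (keep s⇝ []⇝)) (swap _ _ ↭-refl)

-- Aho's construction

splits? : ∀ S T e → Dec (Splits S T e)
splits? S T e = (Triplet.a e ∈? S ×-dec Triplet.b e ∈? T) ⊎-dec (Triplet.b e ∈? S ×-dec Triplet.a e ∈? T)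

within? : ∀ L e → Dec (Within L e)
within? L e = all? (_∈? L) (labels e)

splits⇒links : ∀ {S T e} → Splits S T e → ∃ λ x → x ∈ T × Links S x e
splits⇒links (inj₁ (a∈S , b∈T)) = _ , b∈T , inj₁ (a∈S , refl)
splits⇒links (inj₂ (b∈S , a∈T)) = _ , a∈T , inj₂ (b∈S , refl)

record Obstruction (R : List Triplet) : Set where
  field
    root : Label
    S : List Label
    E : List Triplet
    connected : Connected root S E
    nonempty : ∃ (_∈ E)
    E-within : All (Within S) E
    E⊆R : All (_∈ R) E

  incompatible : ∀ {R′} → All (_∈ R′) E → Incompatible R′
  incompatible E⊆R′ (T , (_ , u) , displays) =
    connected-¬displays connected (proj₂ nonempty) E-within T u (All.map (All.lookup displays) E⊆R′)

  length-E≤ : ∀ {n} → length S ≤ n → length E ≤ n ∸ 1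
  length-E≤ {n} |S|≤n = subst (length E ≤_) (pred[m∸n]≡m∸[1+n] n 0)
    (suc[m]≤n⇒m≤pred[n] (subst (_≤ n) (connected-length connected) |S|≤n))

module Aho (R : List Triplet) where

  record Component (L : List Label) (r : Label) : Set where
    constructor component
    field
      S rest : List Label
      E : List Triplet
      connected : Connected r S E
      partition : S ++ rest ↭ L
      E⊆R : All (_∈ R) E
      E-within : All (Within L) E
      closed : ∀ {e} → e ∈ R → Within L e → ¬ Splits S rest e

  grow : ∀ k {L r S rest E} → length rest ≤ k → Connected r S E → S ++ rest ↭ L →
    All (_∈ R) E → All (Within L) E → Component L r
  grow zero {rest = []} _ conn part E⊆R E-within =
    component _ [] _ conn part E⊆R E-within λ _ _ → λ { (inj₁ (_ , ())) ; (inj₂ (_ , ())) }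
  grow zero {rest = _ ∷ _} ()
  grow (suc k) {L} {S = S} {rest} len conn part E⊆R E-within
    with any? (λ e → within? L e ×-dec splits? S rest e) R
  ... | no none = component S rest _ conn part E⊆R E-within λ e∈R w sp → none (lose e∈R (w , sp))
  ... | yes some with find some
  ... | e , e∈R , w , sp with splits⇒links {S} {rest} {e} sp
  ... | x , x∈rest , links =
    grow k (s≤s⁻¹ (subst (_≤ suc k) (↭-length (↭-─ x∈rest)) len)) (extend e conn links)
      (↭-trans (↭-sym (shift x S (rest ─ x∈rest))) (↭-trans (++⁺ˡ S (↭-sym (↭-─ x∈rest))) part))
      (e∈R ∷ E⊆R) (w ∷ E-within)

  data Result (L : List Label) : Set where
    built : (B : BinTree) → (∀ {x} → x ∈ leavesᵇ B → x ∈ L) → (∀ {x} → x ∈ L → x ∈ leavesᵇ B) →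
      Unique (leavesᵇ B) → (∀ {e} → e ∈ R → Within L e → Displays ⌊ B ⌋ (tripletTree e)) → Result L
    stuck : (o : Obstruction R) → length (Obstruction.S o) ≤ length L → Result L

  join : ∀ {L S rest} → S ++ rest ↭ L → Unique L → (∀ {e} → e ∈ R → Within L e → ¬ Splits S rest e) →
    Result S → Result rest → Result L
  join {S = S} part _ _ (stuck o small) _ =
    stuck o (≤-trans small (≤-trans (length-++-≤ˡ S) (≤-reflexive (↭-length part))))
  join {S = S} {rest} part _ _ (built _ _ _ _ _) (stuck o small) =
    stuck o (≤-trans small (≤-trans (length-++-≤ʳ rest {S}) (≤-reflexive (↭-length part))))
  join {L} {S} part uL closed (built B₁ B₁⊆S S⊆B₁ u₁ D₁) (built B₂ B₂⊆rest rest⊆B₂ u₂ D₂) =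
    built (bin B₁ B₂) B⊆L L⊆B u D
    where
    S#rest : Disjoint S _
    S#rest = proj₂ (proj₂ (Unique-++⁻ S (Unique-resp-↭ (↭-sym part) uL)))
    side : ∀ {x} → x ∈ L → x ∈ leavesᵇ B₁ ⊎ x ∈ leavesᵇ B₂
    side x∈L = Sum.map S⊆B₁ rest⊆B₂ (∈-++⁻ S (∈-resp-↭ (↭-sym part) x∈L))
    B⊆L : ∀ {x} → x ∈ leavesᵇ (bin B₁ B₂) → x ∈ L
    B⊆L x∈B = ∈-resp-↭ part (Sum.[ ∈-++⁺ˡ ∘ B₁⊆S , ∈-++⁺ʳ S ∘ B₂⊆rest ] (∈-++⁻ (leavesᵇ B₁) x∈B))
    L⊆B : ∀ {x} → x ∈ L → x ∈ leavesᵇ (bin B₁ B₂)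
    L⊆B x∈L = Sum.[ ∈-++⁺ˡ , ∈-++⁺ʳ (leavesᵇ B₁) ] (side x∈L)
    u : Unique (leavesᵇ (bin B₁ B₂))
    u = Unique.++⁺ u₁ u₂ λ (x∈₁ , x∈₂) → S#rest (B₁⊆S x∈₁ , B₂⊆rest x∈₂)
    D : ∀ {e} → e ∈ R → Within L e → Displays ⌊ bin B₁ B₂ ⌋ (tripletTree e)
    D {e} e∈R w = displays-bin B₁ B₂ e u (All.map side w)
      (closed e∈R w ∘ Sum.map (Product.map B₁⊆S B₂⊆rest) (Product.map B₁⊆S B₂⊆rest))
      (D₁ e∈R ∘ All.map B₁⊆S) (D₂ e∈R ∘ All.map B₂⊆rest)

  whole-component : ∀ {L r S E} → Connected r S E → S ++ [] ↭ L → 2 ≤ length L →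
    All (_∈ R) E → All (Within L) E → Result L
  whole-component {L} {r} {S} {E} conn part 2≤|L| E⊆R E-within = stuck obstruction (≤-reflexive |S|≡|L|)
    where
    S↭L : S ↭ L
    S↭L = subst (_↭ L) (++-identityʳ S) part
    |S|≡|L| : length S ≡ length L
    |S|≡|L| = ↭-length S↭L
    obstruction : Obstruction R
    obstruction = record
      { root = r ; S = S ; E = E ; connected = conn
      ; nonempty = connected-edge conn (subst (2 ≤_) (sym |S|≡|L|) 2≤|L|)
      ; E-within = All.map (All.map (∈-resp-↭ (↭-sym S↭L))) E-within
      ; E⊆R = E⊆R }

  build : ∀ k L → length L ≤ k → Unique L → 0 < length L → Result L
  build k [] _ _ ()
  build zero (_ ∷ _) () _ _
  build (suc k) (x ∷ []) _ _ _ =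
    built (tip x) id id ([] ∷ []) λ {e} _ → λ { (here refl ∷ here b≡a ∷ _) → ⊥-elim (Triplet.a≢b e (sym b≡a)) }
  build (suc k) L@(x ∷ y ∷ ys) |L|≤1+k uL _ = split (grow (length (y ∷ ys)) ≤-refl start ↭-refl [] [])
    where
    smaller : ∀ (xs : List Label) → length xs < length L → length xs ≤ k
    smaller _ |xs|<|L| = s≤s⁻¹ (≤-trans |xs|<|L| |L|≤1+k)
    split : Component L x → Result L
    split (component [] _ _ () _ _ _ _)
    split (component S [] E conn part E⊆R E-within _) =
      whole-component conn part (s≤s (s≤s z≤n)) E⊆R E-within
    split (component S@(_ ∷ S′) rest@(z ∷ zs) E conn part E⊆R E-within closed) =
      join part uL closed
        (build k S (smaller S |S|<|L|) uS (s≤s z≤n))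
        (build k rest (smaller rest |rest|<|L|) urest (s≤s z≤n))
      where
      uS : Unique S
      uS = proj₁ (Unique-++⁻ S (Unique-resp-↭ (↭-sym part) uL))
      urest : Unique rest
      urest = proj₁ (proj₂ (Unique-++⁻ S (Unique-resp-↭ (↭-sym part) uL)))
      |S|<|L| : length S < length L
      |S|<|L| = ≤-trans (s≤s (length-++-≤ˡ S)) (≤-reflexive (trans (sym (length-++-sucʳ S z zs)) (↭-length part)))
      |rest|<|L| : length rest < length L
      |rest|<|L| = ≤-trans (s≤s (length-++-≤ʳ rest {S′})) (≤-reflexive (↭-length part))

∈-tripletLabels : ∀ {R e x} → e ∈ R → x ∈ labels e → x ∈ tripletLabels R
∈-tripletLabels e∈R x∈e = ∈-concatMap⁺ labels (Any.map (λ { refl → x∈e }) e∈R)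

theorem7 : (n : ℕ) → 3 ≤ n → (R : List Triplet) → TripletSet R →
    OverLabels R n → Incompatible R → n ∸ 1 < length R →
    Σ (List Triplet) λ R' → (R' ⊆ R) × (length R' < length R) × Incompatible R'
theorem7 n 3≤n R _ (L , uL , L⇔labels , refl) incompatible |R|>n∸1
  with Aho.build R (length L) L ≤-refl uL (≤-trans (s≤s z≤n) 3≤n)
... | Aho.built B _ _ u displays =
  ⊥-elim (incompatible (⌊ B ⌋ , (shape-⌊⌋ B , subst Unique (sym (leaves-⌊⌋ B)) u) ,
    All.tabulate λ e∈R → displays e∈R (All.tabulate (Equivalence.from (L⇔labels _) ∘ ∈-tripletLabels e∈R))))
... | Aho.stuck o |S|≤|L| =
  let R′ , R′⊆R , |R′|≤|E| , E⊆R′ = covering-sublist (Obstruction.E⊆R o) in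
  R′ , R′⊆R , ≤-<-trans |R′|≤|E| (≤-<-trans (Obstruction.length-E≤ o |S|≤|L|) |R|>n∸1) ,
  Obstruction.incompatible o E⊆R′
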